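{- For every positive integer $n$, $$W_{n+1}^2+qW_n^2=W_1W_{2n+1}+qW_0W_{2n}.$$
   Context: Let $H$ be the real quaternion algebra with basis $1,i,j,k$ and (non-commutative) multiplication determined by $i^2=j^2=k^2=-1$, $ij=-ji=k$, $jk=-kj=i$, $ki=-ik=j$; real scalars commute with all quaternions. Fix real numbers $p,q$. The Horadam sequence $w_n=w_n(w_0,w_1;p,q)$ has real initial values $w_0,w_1$ and satisfies $w_n=pw_{n-1}+qw_{n-2}$ for $n\ge 2$. The Horadam quaternions are $W_n=w_n+w_{n+1}i+w_{n+2}j+w_{n+3}k$, and $W_n^2=W_nW_n$. -}

module Defs where

open import Level using (_⊔_)
open import Data.Nat using (ℕ; zero; suc)
open import Data.Product using (_×_; _,_)
open import Algebra.Bundles using (CommutativeRing)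

module Quat {c ℓ} (R : CommutativeRing c ℓ) where
  open CommutativeRing R

  record ℍ : Set c where
    constructor quat
    field
      re : Carrier
      im-i : Carrier
      im-j : Carrier
      im-k : Carrier
  open ℍ public

  infix 4 _≈ℍ_
  _≈ℍ_ : ℍ → ℍ → Set ℓ
  x ≈ℍ y = (re x ≈ re y) × (im-i x ≈ im-i y) × (im-j x ≈ im-j y) × (im-k x ≈ im-k y)

  infixl 6 _+ℍ_
  _+ℍ_ : ℍ → ℍ → ℍ
  quat a b c' d +ℍ quat a' b' c'' d' = quat (a + a') (b + b') (c' + c'') (d + d')

  infixl 7 _·ℍ_
  _·ℍ_ : Carrier → ℍ → ℍ
  s ·ℍ quat a b c' d = quat (s * a) (s * b) (s * c') (s * d)

  -- Hamilton product: i² = j² = k² = -1, ij = -ji = k, jk = -kj = i, ki = -ik = j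
  infixl 7 _*ℍ_
  _*ℍ_ : ℍ → ℍ → ℍ
  quat a₁ b₁ c₁ d₁ *ℍ quat a₂ b₂ c₂ d₂ = quat
    (a₁ * a₂ - b₁ * b₂ - c₁ * c₂ - d₁ * d₂)
    (a₁ * b₂ + b₁ * a₂ + c₁ * d₂ - d₁ * c₂)
    (a₁ * c₂ - b₁ * d₂ + c₁ * a₂ + d₁ * b₂)
    (a₁ * d₂ + b₁ * c₂ - c₁ * b₂ + d₁ * a₂)

  horadam : (w₀ w₁ p q : Carrier) → ℕ → Carrier
  horadam w₀ w₁ p q zero = w₀
  horadam w₀ w₁ p q (suc zero) = w₁
  horadam w₀ w₁ p q (suc (suc n)) =
    p * horadam w₀ w₁ p q (suc n) + q * horadam w₀ w₁ p q n

  horadamQ : (w₀ w₁ p q : Carrier) → ℕ → ℍ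
  horadamQ w₀ w₁ p q n = quat (w n) (w (suc n)) (w (suc (suc n))) (w (suc (suc (suc n))))
    where w = horadam w₀ w₁ p q

module Submission where

-- The corollary is the diagonal case m = n of the product
-- formula
--     W_{n+1} W_{m+1} + q W_n W_m = W_1 W_{n+m+1} + q W_0 W_{n+m}   (all n, m),
-- which holds over any commutative ring.  Every coordinate of a Hamilton
-- product is a signed sum of products x_a y_b of coordinates, and the
-- coordinates of W_k are the shifted Horadam terms w_{k}, …, w_{k+3}.  So it
-- suffices to prove the scalar "convolution" identity
--     s_{n+1} t_{m+1} + q s_n t_m = s_1 t_{n+m+1} + q s_0 t_{n+m}
-- for any two sequences s, t obeying the same recurrence x_{k+2} = p x_{k+1} + q x_k
-- (induction on n, moving one index from s to t at each step), and to note
-- that equations between combinations  a + q·c  survive sums and differences.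

open import Defs
open import Data.Nat as ℕ using (ℕ; zero; suc; _≤_)
open import Algebra.Bundles using (CommutativeRing)
open import Data.Nat.Properties using (+-suc; +-identityʳ)
open import Data.Product using (_,_)
open import Relation.Binary.PropositionalEquality as ≡ using (_≡_)

module ProductFormula {c ℓ} (R : CommutativeRing c ℓ) where
  open CommutativeRing R
  open Quat R
  open import Algebra.Properties.Ring ring using (-‿distribʳ-*)
  open import Algebra.Properties.AbelianGroup +-abelianGroup using (⁻¹-∙-comm)
  open import Algebra.Solver.Ring.NaturalCoefficients.Default commutativeSemiring
    using (solve; _:+_; _:*_; _:=_)
  open import Relation.Binary.Reasoning.Setoid setoid

  -- Both sides of the product formula, coordinate by coordinate, have the
  -- shape  a + q·c  where a is a product of neighbours and c one of predecessors.
  twisted : Carrier → Carrier → Carrier → Carrier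
  twisted q a c = a + q * c

  twisted-+ : ∀ q a₁ c₁ a₂ c₂ →
              twisted q (a₁ + a₂) (c₁ + c₂) ≈ twisted q a₁ c₁ + twisted q a₂ c₂
  twisted-+ = solve 5 (λ q a₁ c₁ a₂ c₂ →
    a₁ :+ a₂ :+ q :* (c₁ :+ c₂) := (a₁ :+ q :* c₁) :+ (a₂ :+ q :* c₂)) refl

  twisted-neg : ∀ q a c → twisted q (- a) (- c) ≈ - twisted q a c
  twisted-neg q a c = begin
    - a + q * - c     ≈⟨ +-congˡ (sym (-‿distribʳ-* q c)) ⟩
    - a + - (q * c)   ≈⟨ ⁻¹-∙-comm a (q * c) ⟩
    - (a + q * c)     ∎

  -- Hence equations between twisted combinations can be added (_⊕_) and
  -- subtracted (_⊖_); this is how the coordinatewise identities assemble into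
  -- Hamilton products.
  infixl 6 _⊕_ _⊖_

  _⊕_ : ∀ {q a₁ c₁ b₁ d₁ a₂ c₂ b₂ d₂} →
        twisted q a₁ c₁ ≈ twisted q b₁ d₁ → twisted q a₂ c₂ ≈ twisted q b₂ d₂ →
        twisted q (a₁ + a₂) (c₁ + c₂) ≈ twisted q (b₁ + b₂) (d₁ + d₂)
  _⊕_ {q} {a₁} {c₁} {b₁} {d₁} {a₂} {c₂} {b₂} {d₂} e₁ e₂ = begin
    twisted q (a₁ + a₂) (c₁ + c₂)          ≈⟨ twisted-+ q a₁ c₁ a₂ c₂ ⟩
    twisted q a₁ c₁ + twisted q a₂ c₂      ≈⟨ +-cong e₁ e₂ ⟩
    twisted q b₁ d₁ + twisted q b₂ d₂      ≈⟨ twisted-+ q b₁ d₁ b₂ d₂ ⟨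
    twisted q (b₁ + b₂) (d₁ + d₂)          ∎

  _⊖_ : ∀ {q a₁ c₁ b₁ d₁ a₂ c₂ b₂ d₂} →
        twisted q a₁ c₁ ≈ twisted q b₁ d₁ → twisted q a₂ c₂ ≈ twisted q b₂ d₂ →
        twisted q (a₁ - a₂) (c₁ - c₂) ≈ twisted q (b₁ - b₂) (d₁ - d₂)
  _⊖_ {q} {a₂ = a₂} {c₂} {b₂} {d₂} e₁ e₂ = e₁ ⊕ (begin
    twisted q (- a₂) (- c₂)    ≈⟨ twisted-neg q a₂ c₂ ⟩
    - twisted q a₂ c₂          ≈⟨ -‿cong e₂ ⟩
    - twisted q b₂ d₂          ≈⟨ twisted-neg q b₂ d₂ ⟨
    twisted q (- b₂) (- d₂)    ∎)

  Recurrent : Carrier → Carrier → (ℕ → Carrier) → Set ℓ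
  Recurrent p q x = ∀ k → x (suc (suc k)) ≈ p * x (suc k) + q * x k

  -- The ring identity behind one induction step: expanding a' = p·a + q·b on
  -- the left and c'' = p·c' + q·d on the right gives the same expression.
  exchange-identity : ∀ p q a b c' d →
    twisted q ((p * a + q * b) * c') (a * d) ≈ twisted q (a * (p * c' + q * d)) (b * c')
  exchange-identity = solve 6 (λ p q a b c' d →
    (p :* a :+ q :* b) :* c' :+ q :* (a :* d) := a :* (p :* c' :+ q :* d) :+ q :* (b :* c')) refl

  module Convolution {p q : Carrier} {s t : ℕ → Carrier}
                     (s-rec : Recurrent p q s) (t-rec : Recurrent p q t) where

    exchange : ∀ n m → twisted q (s (suc (suc n)) * t (suc m)) (s (suc n) * t m)
                     ≈ twisted q (s (suc n) * t (suc (suc m))) (s n * t (suc m))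
    exchange n m = begin
      twisted q (s (suc (suc n)) * t (suc m)) (s (suc n) * t m)
        ≈⟨ +-congʳ (*-congʳ (s-rec n)) ⟩
      twisted q ((p * s (suc n) + q * s n) * t (suc m)) (s (suc n) * t m)
        ≈⟨ exchange-identity p q (s (suc n)) (s n) (t (suc m)) (t m) ⟩
      twisted q (s (suc n) * (p * t (suc m) + q * t m)) (s n * t (suc m))
        ≈⟨ +-congʳ (*-congˡ (t-rec m)) ⟨
      twisted q (s (suc n) * t (suc (suc m))) (s n * t (suc m))
        ∎

    convolution : ∀ n m → twisted q (s (suc n) * t (suc m)) (s n * t m)
                        ≈ twisted q (s 1 * t (suc (n ℕ.+ m))) (s 0 * t (n ℕ.+ m))
    convolution zero    m = refl
    convolution (suc n) m = begin
      twisted q (s (suc (suc n)) * t (suc m)) (s (suc n) * t m)  ≈⟨ exchange n m ⟩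
      twisted q (s (suc n) * t (suc (suc m))) (s n * t (suc m))  ≈⟨ convolution n (suc m) ⟩
      twisted q (s 1 * t (suc (n ℕ.+ suc m))) (s 0 * t (n ℕ.+ suc m))
        ≡⟨ ≡.cong (λ k → twisted q (s 1 * t (suc k)) (s 0 * t k)) (+-suc n m) ⟩
      twisted q (s 1 * t (suc (suc n ℕ.+ m))) (s 0 * t (suc n ℕ.+ m)) ∎

  module Horadam (w₀ w₁ p q : Carrier) where
    w : ℕ → Carrier
    w = horadam w₀ w₁ p q

    W : ℕ → ℍ
    W = horadamQ w₀ w₁ p q

    -- Every shift k ↦ w_{i+k} of the Horadam sequence satisfies its recurrence;
    -- these shifts are the coordinate sequences of the Horadam quaternions.
    shift-recurrent : ∀ i → Recurrent p q (λ k → w (i ℕ.+ k))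
    shift-recurrent i k rewrite +-suc i (suc k) | +-suc i k = refl

    module _ (n m : ℕ) where
      conv : ∀ i j →
        twisted q (w (i ℕ.+ suc n) * w (j ℕ.+ suc m)) (w (i ℕ.+ n) * w (j ℕ.+ m))
          ≈ twisted q (w (i ℕ.+ 1) * w (j ℕ.+ suc (n ℕ.+ m))) (w (i ℕ.+ 0) * w (j ℕ.+ (n ℕ.+ m)))
      conv i j = Convolution.convolution (shift-recurrent i) (shift-recurrent j) n m

      -- Product formula for Horadam quaternions: each coordinate of the Hamilton
      -- product is the signed sum of coordinate convolutions dictated by the
      -- multiplication table of i, j, k.
      product-formula : (W (suc n) *ℍ W (suc m)) +ℍ (q ·ℍ (W n *ℍ W m))
                          ≈ℍ (W 1 *ℍ W (suc (n ℕ.+ m))) +ℍ (q ·ℍ (W 0 *ℍ W (n ℕ.+ m)))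
      product-formula =
          conv 0 0 ⊖ conv 1 1 ⊖ conv 2 2 ⊖ conv 3 3
        , conv 0 1 ⊕ conv 1 0 ⊕ conv 2 3 ⊖ conv 3 2
        , conv 0 2 ⊖ conv 1 3 ⊕ conv 2 0 ⊕ conv 3 1
        , conv 0 3 ⊕ conv 1 2 ⊖ conv 2 1 ⊕ conv 3 0

open import Data.Nat using (_+_; _*_)

corollary2p1 : ∀ {c ℓ} (R : CommutativeRing c ℓ) → let open Quat R in (w₀ w₁ p q : CommutativeRing.Carrier R) → let W = horadamQ w₀ w₁ p q in (n : ℕ) → 1 ≤ n → (W (suc n) *ℍ W (suc n)) +ℍ (q ·ℍ (W n *ℍ W n)) ≈ℍ (W 1 *ℍ W (suc (2 * n))) +ℍ (q ·ℍ (W 0 *ℍ W (2 * n)))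
corollary2p1 R w₀ w₁ p q n _ =
  ≡.subst (λ k → (W (suc n) *ℍ W (suc n)) +ℍ (q ·ℍ (W n *ℍ W n))
                   ≈ℍ (W 1 *ℍ W (suc k)) +ℍ (q ·ℍ (W 0 *ℍ W k)))
          n+n≡2n
          (product-formula n n)
  where
  open Quat R
  open ProductFormula.Horadam R w₀ w₁ p q
  -- The diagonal m = n of the product formula.
  n+n≡2n : n + n ≡ 2 * n
  n+n≡2n = ≡.cong (n +_) (≡.sym (+-identityʳ n))
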